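{- Let $G=(V,E)$ be a finite graph with boundary $B\subseteq V$, $|B|\ge2$, with maximum degree $\Delta\ge3$, and let $t\ge1$ be an integer such that the boundary diameter satisfies $D_B\ge 2t+2$. Let $q=\Delta-1$. Then $$\sigma_2(G,B)\le \frac{(q+1)(q^{t+1}-q^t+1)}{q^{t+1}}=q-\frac{q^t-q-1}{q^{t+1}}.$$ Moreover, the right-hand side is monotone decreasing in $t$.
   Context: The boundary diameter is $D_B=\max_{x,y\in B}\mathrm{dist}_G(x,y)$, where $\mathrm{dist}_G$ is the graph distance in $G$. Steklov eigenvalue: $\sigma_2(G,B)=\min\{R(f): f\in\mathbb{R}^V,\ f|_B\not\equiv0,\ \sum_{x\in B}f(x)=0\}$, where $R(f)=\frac{\sum_{(x,y)\in E}(f(x)-f(y))^2}{\sum_{x\in B}f(x)^2}$. -}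

module Defs where

open import Data.Bool using (Bool; true; false; if_then_else_)
open import Data.Nat as ℕ using (ℕ; zero; suc; _∸_; _^_; NonZero; _≤_; s≤s; z≤n)
import Data.Nat.Properties as ℕP
open import Data.Fin using (Fin; zero; suc; toℕ)
open import Data.Integer using (+_)
open import Data.Rational as ℚ using (ℚ; 0ℚ; _+_; _*_; _-_; _/_)
open import Data.Product using (Σ; _×_; _,_)
open import Data.Sum using (_⊎_)
open import Relation.Binary.PropositionalEquality using (_≡_; _≢_)

record Graph : Set where
  field
    n     : ℕ
    adj   : Fin n → Fin n → Bool
    sym   : ∀ x y → adj x y ≡ adj y x
    irrefl : ∀ x → adj x x ≡ false
open Graph public

sumℚ : ∀ {m} → (Fin m → ℚ) → ℚ
sumℚ {zero}  f = 0ℚ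
sumℚ {suc m} f = f zero + sumℚ (λ i → f (suc i))

count : ∀ {m} → (Fin m → Bool) → ℕ
count {zero}  p = 0
count {suc m} p = (if p zero then 1 else 0) ℕ.+ count (λ i → p (suc i))

maxFin : ∀ {m} → (Fin m → ℕ) → ℕ
maxFin {zero}  f = 0
maxFin {suc m} f = f zero ℕ.⊔ maxFin (λ i → f (suc i))

degree : (G : Graph) → Fin (n G) → ℕ
degree G x = count (adj G x)

maxDegree : Graph → ℕ
maxDegree G = maxFin (degree G)

Boundary : Graph → Set
Boundary G = Fin (n G) → Bool

card : (G : Graph) → Boundary G → ℕ
card G B = count B

-- Walk reachability: Reach k x y  iff  dist_G(x,y) ≤ k.
Reach : (G : Graph) → ℕ → Fin (n G) → Fin (n G) → Set
Reach G zero    x y = x ≡ y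
Reach G (suc k) x y = Reach G k x y ⊎ Σ (Fin (n G)) (λ z → Reach G k x z × adj G z y ≡ true)

-- dist_G(x,y) ≥ m  (m ≥ 1), i.e. no walk of length ≤ m - 1;
-- vertices in different components have infinite distance.
DistAtLeast : (G : Graph) → ℕ → Fin (n G) → Fin (n G) → Set
DistAtLeast G m x y = Reach G (m ∸ 1) x y → Data.Empty.⊥
  where import Data.Empty

BoundaryDiamAtLeast : (G : Graph) → Boundary G → ℕ → Set
BoundaryDiamAtLeast G B m =
  Σ (Fin (n G)) λ x → Σ (Fin (n G)) λ y →
    B x ≡ true × B y ≡ true × DistAtLeast G m x y

sq : ℚ → ℚ
sq a = a * a

-- numerator of the Rayleigh quotient: sum over edges {x,y} (each once, x < y)
energy : (G : Graph) → (Fin (n G) → ℚ) → ℚ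
energy G f = sumℚ λ x → sumℚ λ y →
  if adj G x y then (if toℕ x ℕ.<ᵇ toℕ y then sq (f x - f y) else 0ℚ) else 0ℚ

bdryNorm : (G : Graph) → Boundary G → (Fin (n G) → ℚ) → ℚ
bdryNorm G B f = sumℚ λ x → if B x then sq (f x) else 0ℚ

bdrySum : (G : Graph) → Boundary G → (Fin (n G) → ℚ) → ℚ
bdrySum G B f = sumℚ λ x → if B x then f x else 0ℚ

Admissible : (G : Graph) → Boundary G → (Fin (n G) → ℚ) → Set
Admissible G B f =
  Σ (Fin (n G)) (λ x → B x ≡ true × f x ≢ 0ℚ) × bdrySum G B f ≡ 0ℚ

-- σ₂(G,B) ≤ c.  σ₂ is the min of R(f) over admissible f ∈ ℝ^V; since R is
-- continuous and ℚ^V is dense, this min equals the infimum over ℚ^V, so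
-- σ₂ ≤ c  iff  for every ε > 0 there is an admissible f ∈ ℚ^V with
-- R(f) ≤ c + ε, i.e. energy f ≤ (c + ε) · Σ_B f² (the denominator is > 0).
σ₂≤ : (G : Graph) → Boundary G → ℚ → Set
σ₂≤ G B c = (ε : ℚ) → 0ℚ ℚ.< ε →
  Σ (Fin (n G) → ℚ) λ f → Admissible G B f ×
    energy G f ℚ.≤ (c + ε) * bdryNorm G B f

-- the bound (q+1)(q^{t+1} - q^t + 1) / q^{t+1}   (note q^{t+1} ≥ q^t for q ≥ 1)
bound : (q t : ℕ) → .{{NonZero q}} → ℚ
bound q t = _/_ (+ ((q ℕ.+ 1) ℕ.* (q ^ suc t ∸ q ^ t ℕ.+ 1)))
              (q ^ suc t) {{ℕP.m^n≢0 q (suc t)}}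

q-nonZero : ∀ {Δ} → 3 ≤ Δ → NonZero (Δ ∸ 1)
q-nonZero (s≤s (s≤s (s≤s _))) = _

module Submission where

-- For a boundary vertex r, the spike at r is q^(t - d(r, v)) on the ball of radius t around r
-- and 0 outside it.  Orient every edge between consecutive BFS levels away from r: the root has
-- at most q + 1 outgoing edges, and every other vertex of the ball has a parent, hence at most q.
-- Charging each outgoing edge at level l with the energy of a complete q-ary branch hanging from
-- it, the charges telescope, so the energy of the spike is at most its energy on the
-- (q + 1)-regular tree, (q + 1) q^(t - 1) ((q - 1) q^t + 1), while its boundary norm is at least
-- q^(2t), the contribution of r.  Boundary vertices x, y at distance at least 2t + 2 carry spikes
-- g, h whose supports are not joined by any edge, so f = (Σ_B h) g - (Σ_B g) h has boundary sum
-- zero, and its energy and boundary norm are the same positive combinations of those of g and h.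

import Data.Bool.Properties as Bool
open import Data.Bool using (Bool; true; false; if_then_else_)
open import Data.Empty using (⊥; ⊥-elim)
open import Data.Fin using (Fin; zero; suc; toℕ)
open import Data.Fin.Properties using (_≟_; any?)
import Data.Integer as ℤ
import Data.Integer.Properties as ℤP
open import Data.Nat as ℕ using (ℕ; zero; suc; _+_; _*_; _∸_; _^_; _≤_; _≤?_; z≤n; s≤s; NonZero; ∣_-_∣)
import Data.Nat.Properties as ℕP
open import Data.Nat.Tactic.RingSolver using (solve-∀)
open import Data.Product as Product using (Σ; _×_; _,_; proj₁; proj₂)
open import Data.Rational as ℚ using (ℚ; 0ℚ; toℚᵘ; _<_)
open import Data.Rational.Literals using (fromℤ)
import Data.Rational.Properties as ℚP
open import Data.Rational.Solver using (module +-*-Solver)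
import Data.Rational.Unnormalised as ℚᵘ
import Data.Rational.Unnormalised.Properties as ℚᵘP
open import Data.Sum as Sum using (_⊎_; inj₁; inj₂)
open import Defs hiding (sym)
open import Function using (_∘_; case_of_)
open import Relation.Binary.PropositionalEquality
open import Relation.Nullary using (¬_; Dec; yes; no; does)
open import Relation.Nullary.Decidable using (_⊎-dec_; _×-dec_)

open import Algebra.Properties.Semiring.Sum ℕP.+-*-semiring
  using (sum; sum-cong-≗; sum-replicate-zero; ∑-distrib-+; ∑-comm; *-distribˡ-sum)
open +-*-Solver using (solve; _:+_; _:*_; _:-_; :-_; con; _:=_)

ι : ℕ → ℚ
ι n = fromℤ (ℤ.+ n)

ι-+ : ∀ m n → ι (m + n) ≡ ι m ℚ.+ ι n
ι-+ m n = ℚP.toℚᵘ-injective (ℚᵘP.≃-trans (ℚᵘ.*≡* eq) (ℚᵘP.≃-sym (ℚP.toℚᵘ-homo-+ (ι m) (ι n))))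
  where
  eq : ℤ.+ (m + n) ℤ.* ℤ.+ 1 ≡ (ℤ.+ m ℤ.* ℤ.+ 1 ℤ.+ ℤ.+ n ℤ.* ℤ.+ 1) ℤ.* ℤ.+ 1
  eq rewrite ℤP.*-identityʳ (ℤ.+ (m + n)) | ℤP.*-identityʳ (ℤ.+ m) | ℤP.*-identityʳ (ℤ.+ n)
           | ℤP.*-identityʳ (ℤ.+ m ℤ.+ ℤ.+ n) = ℤP.pos-+ m n

ι-* : ∀ m n → ι (m * n) ≡ ι m ℚ.* ι n
ι-* m n = ℚP.toℚᵘ-injective (ℚᵘP.≃-trans (ℚᵘ.*≡* eq) (ℚᵘP.≃-sym (ℚP.toℚᵘ-homo-* (ι m) (ι n))))
  where
  eq : ℤ.+ (m * n) ℤ.* ℤ.+ 1 ≡ (ℤ.+ m ℤ.* ℤ.+ n) ℤ.* ℤ.+ 1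
  eq rewrite ℤP.*-identityʳ (ℤ.+ (m * n)) | ℤP.*-identityʳ (ℤ.+ m ℤ.* ℤ.+ n) = ℤP.pos-* m n

ι-injective : ∀ {m n} → ι m ≡ ι n → m ≡ n
ι-injective = ℤP.+-injective ∘ cong ℚ.↥_

toℚᵘ-/ : ∀ n d .{{_ : NonZero d}} → toℚᵘ (ℤ.+ n ℚ./ d) ℚᵘ.≃ ℚᵘ.mkℚᵘ (ℤ.+ n) (ℕ.pred d)
toℚᵘ-/ n (suc d) = ℚP.toℚᵘ-fromℚᵘ (ℚᵘ.mkℚᵘ (ℤ.+ n) d)

ι-≤-/-* : ∀ m n p d .{{_ : NonZero d}} → m * d ≤ n * p → ι m ℚ.≤ (ℤ.+ n ℚ./ d) ℚ.* ι p
ι-≤-/-* m n p (suc d) md≤np = ℚP.toℚᵘ-cancel-≤ (ℚᵘP.≤-respʳ-≃ toℚᵘ-rhs (ℚᵘ.*≤* ineq))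
  where
  toℚᵘ-rhs : ℚᵘ.mkℚᵘ (ℤ.+ n) d ℚᵘ.* toℚᵘ (ι p) ℚᵘ.≃ toℚᵘ ((ℤ.+ n ℚ./ suc d) ℚ.* ι p)
  toℚᵘ-rhs = ℚᵘP.≃-sym (ℚᵘP.≃-trans (ℚP.toℚᵘ-homo-* (ℤ.+ n ℚ./ suc d) (ι p))
                                    (ℚᵘP.*-congʳ (toℚᵘ-/ n (suc d))))
  ineq : ℤ.+ m ℤ.* ℤ.+ (suc d * 1) ℤ.≤ (ℤ.+ n ℤ.* ℤ.+ p) ℤ.* ℤ.+ 1
  ineq rewrite ℕP.*-identityʳ (suc d) | ℤP.*-identityʳ (ℤ.+ n ℤ.* ℤ.+ p)
             | sym (ℤP.pos-* m (suc d)) | sym (ℤP.pos-* n p) = ℤ.+≤+ md≤np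

/-<-/ : ∀ m n d e .{{_ : NonZero d}} .{{_ : NonZero e}} → m * e ℕ.< n * d → ℤ.+ m ℚ./ d ℚ.< ℤ.+ n ℚ./ e
/-<-/ m n (suc d) (suc e) me<nd = ℚP.toℚᵘ-cancel-<
  (ℚᵘP.<-respˡ-≃ (ℚᵘP.≃-sym (toℚᵘ-/ m (suc d)))
                 (ℚᵘP.<-respʳ-≃ (ℚᵘP.≃-sym (toℚᵘ-/ n (suc e))) (ℚᵘ.*<* ineq)))
  where
  ineq : ℤ.+ m ℤ.* ℤ.+ suc e ℤ.< ℤ.+ n ℤ.* ℤ.+ suc d
  ineq rewrite sym (ℤP.pos-* m (suc e)) | sym (ℤP.pos-* n (suc d)) = ℤ.+<+ me<nd


infix 8 ∣_-_∣²
∣_-_∣² : ℕ → ℕ → ℕ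
∣ m - n ∣² = ∣ m - n ∣ * ∣ m - n ∣

if-yes : ∀ {A : Set} (a? : Dec A) {m n : ℕ} → A → (if does a? then m else n) ≡ m
if-yes (yes _) a = refl
if-yes (no ¬a) a = ⊥-elim (¬a a)

if-no : ∀ {A : Set} (a? : Dec A) {m n : ℕ} → ¬ A → (if does a? then m else n) ≡ n
if-no (yes a) ¬a = ⊥-elim (¬a a)
if-no (no _)  ¬a = refl

if-split : ∀ {A : Set} (a? : Dec A) {m k l : ℕ} → (A → m ≡ k + l) →
  (if does a? then m else 0) ≡ (if does a? then k else 0) + (if does a? then l else 0)
if-split (yes a) m≡k+l = m≡k+l a
if-split (no _)  m≡k+l = refl

if-≤ : ∀ b {m n} → (b ≡ true → m ≤ n) → (if b then m else 0) ≤ n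
if-≤ true  m≤n = m≤n refl
if-≤ false m≤n = z≤n

*-if : ∀ m b n → m * (if b then n else 0) ≡ (if b then m * n else 0)
*-if m true  n = refl
*-if m false n = ℕP.*-zeroʳ m

suc-∸-cases : ∀ a l → (suc a ∸ l ≡ suc (a ∸ l)) ⊎ (suc a ∸ l ≡ 0 × a ∸ l ≡ 0)
suc-∸-cases a       zero    = inj₁ refl
suc-∸-cases zero    (suc l) = inj₂ (ℕP.0∸n≡0 l , refl)
suc-∸-cases (suc a) (suc l) = suc-∸-cases a l

∑-mono-≤ : ∀ {k} {f g : Fin k → ℕ} → (∀ i → f i ≤ g i) → sum f ≤ sum g
∑-mono-≤ {zero}  f≤g = z≤n
∑-mono-≤ {suc k} f≤g = ℕP.+-mono-≤ (f≤g zero) (∑-mono-≤ (f≤g ∘ suc))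

term-≤-∑ : ∀ {k} (f : Fin k → ℕ) i → f i ≤ sum f
term-≤-∑ f zero    = ℕP.m≤m+n (f zero) _
term-≤-∑ f (suc i) = ℕP.≤-trans (term-≤-∑ (f ∘ suc) i) (ℕP.m≤n+m _ (f zero))

∑-δ : ∀ {k} (r : Fin k) c → sum (λ i → if does (i ≟ r) then c else 0) ≡ c
∑-δ {suc k} zero c = trans (cong (c +_) (sum-replicate-zero k)) (ℕP.+-identityʳ c)
∑-δ (suc r) c = ∑-δ r c

count-* : ∀ {k} (p : Fin k → Bool) m → count p * m ≡ sum (λ i → if p i then m else 0)
count-* {zero}  p m = refl
count-* {suc k} p m with p zero
... | true  = cong (m +_) (count-* (p ∘ suc) m)
... | false = count-* (p ∘ suc) m

count≡∑ : ∀ {k} (p : Fin k → Bool) → count p ≡ sum (λ i → if p i then 1 else 0)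
count≡∑ p = trans (sym (ℕP.*-identityʳ (count p))) (count-* p 1)

if-exclusive : ∀ {A B : Set} (a? : Dec A) (b? : Dec B) c →
  (A → c ≡ true) → (B → c ≡ true) → (A → B → ⊥) →
  (if does a? then 1 else 0) + (if does b? then 1 else 0) ≤ (if c then 1 else 0)
if-exclusive (yes a) (yes b) c       _   _   a∧b = ⊥-elim (a∧b a b)
if-exclusive (yes a) (no _)  true    _   _   _   = ℕP.≤-refl
if-exclusive (yes a) (no _)  false   a⇒c _   _   = case a⇒c a of λ ()
if-exclusive (no _)  (yes b) true    _   _   _   = ℕP.≤-refl
if-exclusive (no _)  (yes b) false   _   b⇒c _   = case b⇒c b of λ ()
if-exclusive (no _)  (no _)  c       _   _   _   = z≤n

≤-maxFin : ∀ {k} (f : Fin k → ℕ) i → f i ≤ maxFin f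
≤-maxFin f zero    = ℕP.m≤m⊔n _ _
≤-maxFin f (suc i) = ℕP.≤-trans (≤-maxFin (f ∘ suc) i) (ℕP.m≤n⊔m (f zero) _)

if-+ : ∀ b m n → (if b then m + n else 0) ≡ (if b then m else 0) + (if b then n else 0)
if-+ true  m n = refl
if-+ false m n = refl

<ᵇ-exclusive : ∀ a b m → (if a ℕ.<ᵇ b then m else 0) + (if b ℕ.<ᵇ a then m else 0) ≤ m
<ᵇ-exclusive zero    zero    m = z≤n
<ᵇ-exclusive zero    (suc b) m = ℕP.≤-reflexive (ℕP.+-identityʳ m)
<ᵇ-exclusive (suc a) zero    m = ℕP.≤-refl
<ᵇ-exclusive (suc a) (suc b) m = <ᵇ-exclusive a b m

∑∑ : ∀ {k} → (Fin k → Fin k → ℕ) → ℕ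
∑∑ f = sum (λ x → sum (f x))

∑∑-mono-≤ : ∀ {k} {f g : Fin k → Fin k → ℕ} → (∀ x y → f x y ≤ g x y) → ∑∑ f ≤ ∑∑ g
∑∑-mono-≤ f≤g = ∑-mono-≤ (λ x → ∑-mono-≤ (f≤g x))

∑∑-distrib : ∀ {k} (f g : Fin k → Fin k → ℕ) {h} →
  (∀ x y → h x y ≡ f x y + g x y) → ∑∑ h ≡ ∑∑ f + ∑∑ g
∑∑-distrib f g h≡f+g = trans (sum-cong-≗ (λ x → trans (sum-cong-≗ (h≡f+g x)) (∑-distrib-+ (f x) (g x))))
                              (∑-distrib-+ (λ x → sum (f x)) (λ x → sum (g x)))

∑∑-ordered-pairs : ∀ {k} (c : Fin k → Fin k → ℕ) →
  ∑∑ (λ x y → if toℕ x ℕ.<ᵇ toℕ y then c x y + c y x else 0) ≤ ∑∑ c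
∑∑-ordered-pairs c = begin
  ∑∑ (λ x y → if x <ᵇ y then c x y + c y x else 0)
    ≡⟨ ∑∑-distrib (λ x y → if x <ᵇ y then c x y else 0) (λ x y → if x <ᵇ y then c y x else 0)
                  (λ x y → if-+ (x <ᵇ y) (c x y) (c y x)) ⟩
  ∑∑ (λ x y → if x <ᵇ y then c x y else 0) + ∑∑ (λ x y → if x <ᵇ y then c y x else 0)
    ≡⟨ cong (∑∑ (λ x y → if x <ᵇ y then c x y else 0) +_)
            (∑-comm (λ x y → if x <ᵇ y then c y x else 0)) ⟩
  ∑∑ (λ x y → if x <ᵇ y then c x y else 0) + ∑∑ (λ x y → if y <ᵇ x then c x y else 0)
    ≡⟨ ∑∑-distrib (λ x y → if x <ᵇ y then c x y else 0) (λ x y → if y <ᵇ x then c x y else 0)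
                  (λ _ _ → refl) ⟨
  ∑∑ (λ x y → (if x <ᵇ y then c x y else 0) + (if y <ᵇ x then c x y else 0))
    ≤⟨ ∑∑-mono-≤ (λ x y → <ᵇ-exclusive (toℕ x) (toℕ y) (c x y)) ⟩
  ∑∑ c ∎
  where
  open ℕP.≤-Reasoning
  _<ᵇ_ : Fin _ → Fin _ → Bool
  x <ᵇ y = toℕ x ℕ.<ᵇ toℕ y

sumℚ-cong : ∀ {k} {f g : Fin k → ℚ} → (∀ i → f i ≡ g i) → sumℚ f ≡ sumℚ g
sumℚ-cong {zero}  f≡g = refl
sumℚ-cong {suc k} f≡g = cong₂ ℚ._+_ (f≡g zero) (sumℚ-cong (f≡g ∘ suc))

0≡lincomb-0 : ∀ a b → 0ℚ ≡ a ℚ.* 0ℚ ℚ.+ b ℚ.* 0ℚ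
0≡lincomb-0 = solve 2 (λ a b → con 0ℚ := a :* con 0ℚ :+ b :* con 0ℚ) refl

sumℚ-lincomb : ∀ {k} a b (f g : Fin k → ℚ) →
  sumℚ (λ i → a ℚ.* f i ℚ.+ b ℚ.* g i) ≡ a ℚ.* sumℚ f ℚ.+ b ℚ.* sumℚ g
sumℚ-lincomb {zero}  a b f g = 0≡lincomb-0 a b
sumℚ-lincomb {suc k} a b f g =
  trans (cong (a ℚ.* f zero ℚ.+ b ℚ.* g zero ℚ.+_) (sumℚ-lincomb a b (f ∘ suc) (g ∘ suc)))
        (regroup a b (f zero) (g zero) (sumℚ (f ∘ suc)) (sumℚ (g ∘ suc)))
  where
  regroup : ∀ a b x y s t →
    a ℚ.* x ℚ.+ b ℚ.* y ℚ.+ (a ℚ.* s ℚ.+ b ℚ.* t) ≡ a ℚ.* (x ℚ.+ s) ℚ.+ b ℚ.* (y ℚ.+ t)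
  regroup = solve 6 (λ a b x y s t → a :* x :+ b :* y :+ (a :* s :+ b :* t)
                                   := a :* (x :+ s) :+ b :* (y :+ t)) refl

sumℚ-ι : ∀ {k} (f : Fin k → ℕ) → sumℚ (ι ∘ f) ≡ ι (sum f)
sumℚ-ι {zero}  f = refl
sumℚ-ι {suc k} f = trans (cong (ι (f zero) ℚ.+_) (sumℚ-ι (f ∘ suc))) (sym (ι-+ (f zero) (sum (f ∘ suc))))

module Walks (G : Graph) where

  V : Set
  V = Fin (n G)

  reach? : ∀ k (x y : V) → Dec (Reach G k x y)
  reach? zero    x y = x ≟ y
  reach? (suc k) x y = reach? k x y ⊎-dec any? (λ z → reach? k x z ×-dec (adj G z y Bool.≟ true))

  reach-mono : ∀ {j k x y} → j ≤ k → Reach G j x y → Reach G k x y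
  reach-mono {zero}  {zero}  z≤n       r                  = r
  reach-mono {zero}  {suc k} z≤n       r                  = inj₁ (reach-mono z≤n r)
  reach-mono {suc j} {suc k} (s≤s j≤k) (inj₁ r)           = inj₁ (reach-mono j≤k r)
  reach-mono {suc j} {suc k} (s≤s j≤k) (inj₂ (z , r , e)) = inj₂ (z , reach-mono j≤k r , e)

  reach-cons : ∀ {k x z y} → adj G x z ≡ true → Reach G k z y → Reach G (suc k) x y
  reach-cons {zero}  {x} e refl               = inj₂ (x , refl , e)
  reach-cons {suc k}     e (inj₁ r)           = inj₁ (reach-cons e r)
  reach-cons {suc k}     e (inj₂ (w , r , f)) = inj₂ (w , reach-cons e r , f)

  reach-++ : ∀ {j k x u y} → Reach G j x u → Reach G k u y → Reach G (j + k) x y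
  reach-++ {zero}          refl               s = s
  reach-++ {suc j} {k}     (inj₁ r)           s = reach-mono (ℕP.n≤1+n (j + k)) (reach-++ r s)
  reach-++ {suc j} {k} {x} {y = y} (inj₂ (z , r , e)) s =
    subst (λ m → Reach G m x y) (ℕP.+-suc j k) (reach-++ r (reach-cons e s))

  reach-sym : ∀ {k x y} → Reach G k x y → Reach G k y x
  reach-sym {zero}          r                  = sym r
  reach-sym {suc k}         (inj₁ r)           = inj₁ (reach-sym r)
  reach-sym {suc k} {y = y} (inj₂ (z , r , e)) = reach-cons (trans (Graph.sym G y z) e) (reach-sym r)

module BoundedSearch {P : ℕ → Set} (P? : ∀ j → Dec (P j)) where

  first : ℕ → ℕ → ℕ
  first i zero    = i
  first i (suc k) = if does (P? i) then i else first (suc i) k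

  first-≤ : ∀ i k → first i k ≤ i + k
  first-≤ i zero = ℕP.≤-reflexive (sym (ℕP.+-identityʳ i))
  first-≤ i (suc k) with P? i
  ... | yes _ = ℕP.m≤m+n i (suc k)
  ... | no  _ = ℕP.≤-trans (first-≤ (suc i) k) (ℕP.≤-reflexive (sym (ℕP.+-suc i k)))

  first-found : ∀ i k → first i k ℕ.< i + k → P (first i k)
  first-found i zero    i<i+0 = ⊥-elim (ℕP.<-irrefl (sym (ℕP.+-identityʳ i)) i<i+0)
  first-found i (suc k) found with P? i
  ... | yes Pi = Pi
  ... | no  _  = first-found (suc i) k (subst (first (suc i) k ℕ.<_) (ℕP.+-suc i k) found)

  first-least : ∀ i k {j} → i ≤ j → j ℕ.< i + k → P j → first i k ≤ j
  first-least i zero    i≤j j<i+0 _ = ⊥-elim (ℕP.<-irrefl (sym (ℕP.+-identityʳ i)) (ℕP.≤-<-trans i≤j j<i+0))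
  first-least i (suc k) {j} i≤j j<i+k Pj with P? i
  ... | yes _  = i≤j
  ... | no ¬Pi = first-least (suc i) k (ℕP.≤∧≢⇒< i≤j (λ { refl → ¬Pi Pj }))
                             (subst (j ℕ.<_) (ℕP.+-suc i k) j<i+k) Pj

module Levels (G : Graph) (r : Fin (n G)) (t : ℕ) where
  open Walks G

  private
    module Search (v : V) = BoundedSearch (λ j → reach? j r v)

  level : V → ℕ
  level v = Search.first v 0 (suc t)

  level-≤ : ∀ v → level v ≤ suc t
  level-≤ v = Search.first-≤ v 0 (suc t)

  level-reach : ∀ v → level v ≤ t → Reach G (level v) r v
  level-reach v ≤t = Search.first-found v 0 (suc t) (s≤s ≤t)

  level-least : ∀ v {j} → j ≤ t → Reach G j r v → level v ≤ j
  level-least v j≤t = Search.first-least v 0 (suc t) z≤n (s≤s j≤t)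

  level-root : level r ≡ 0
  level-root = ℕP.n≤0⇒n≡0 (level-least r z≤n refl)

  level-zero : ∀ v → level v ≡ 0 → r ≡ v
  level-zero v ≡0 = subst (λ j → Reach G j r v) ≡0 (level-reach v (subst (_≤ t) (sym ≡0) z≤n))

  level-ball : ∀ v → level v ≤ t → Reach G t r v
  level-ball v ≤t = reach-mono ≤t (level-reach v ≤t)

  level-adj : ∀ u w → adj G u w ≡ true → level w ≤ suc (level u)
  level-adj u w e with suc (level u) ≤? t
  ... | yes <t = level-least w <t (inj₂ (u , level-reach u (ℕP.<⇒≤ <t) , e))
  ... | no  ≮t = ℕP.≤-trans (level-≤ w) (s≤s (ℕP.≤-pred (ℕP.≰⇒> ≮t)))

  level-parent : ∀ v {j} → level v ≡ suc j → suc j ≤ t → Σ V (λ z → adj G z v ≡ true × level z ≡ j)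
  level-parent v {j} ≡1+j 1+j≤t
    with subst (λ m → Reach G m r v) ≡1+j (level-reach v (subst (_≤ t) (sym ≡1+j) 1+j≤t))
  ... | inj₁ r→v = ⊥-elim (ℕP.<-irrefl refl (subst (_≤ j) ≡1+j (level-least v (ℕP.<⇒≤ 1+j≤t) r→v)))
  ... | inj₂ (z , r→z , e) = z , e , ℕP.≤-antisym (level-least z (ℕP.<⇒≤ 1+j≤t) r→z)
                                        (ℕP.≤-pred (subst (_≤ suc (level z)) ≡1+j (level-adj z v e)))

energyℕ : (G : Graph) → (Fin (n G) → ℕ) → ℕ
energyℕ G g = ∑∑ (λ x y → if adj G x y then (if toℕ x ℕ.<ᵇ toℕ y then ∣ g x - g y ∣² else 0) else 0)

bdryNormℕ : (G : Graph) → Boundary G → (Fin (n G) → ℕ) → ℕ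
bdryNormℕ G B g = sum (λ x → if B x then g x * g x else 0)

bdrySumℕ : (G : Graph) → Boundary G → (Fin (n G) → ℕ) → ℕ
bdrySumℕ G B g = sum (λ x → if B x then g x else 0)

module Spike (G : Graph) (r : Fin (n G)) (t p : ℕ) (maxDegree≤ : maxDegree G ≤ suc (suc p)) where
  open Walks G
  open Levels G r t

  q : ℕ
  q = suc p

  profile : ℕ → ℕ
  profile zero    = 0
  profile (suc k) = q ^ k

  -- The energy of the profile on a branch of the (q + 1)-regular tree below a vertex of height k:
  -- the edge down to height k - 1 and the q branches below that.
  branchEnergy : ℕ → ℕ
  branchEnergy zero    = 0
  branchEnergy (suc k) = ∣ profile (suc k) - profile k ∣² + q * branchEnergy k

  height : ℕ → ℕ
  height l = suc t ∸ l

  spike : V → ℕ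
  spike v = profile (height (level v))

  stepEnergy : ℕ → ℕ
  stepEnergy l = ∣ profile (height l) - profile (height (suc l)) ∣²

  potential : ℕ → ℕ
  potential l = branchEnergy (height l)

  potential-step : ∀ l → potential l ≡ stepEnergy l + q * potential (suc l)
  potential-step l with suc-∸-cases t l
  ... | inj₁ h≡1+h′        rewrite h≡1+h′ = refl
  ... | inj₂ (h≡0 , h′≡0) rewrite h≡0 | h′≡0 = sym (ℕP.*-zeroʳ q)

  potential-vanish : ∀ l → t ℕ.< l → potential l ≡ 0
  potential-vanish l t<l = cong branchEnergy (ℕP.m≤n⇒m∸n≡0 t<l)

  spike-root : spike r ≡ q ^ t
  spike-root = cong (profile ∘ height) level-root

  spike-ball : ∀ v → spike v ≢ 0 → Reach G t r v
  spike-ball v spike≢0 with level v ≤? t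
  ... | yes ≤t = level-ball v ≤t
  ... | no  ≰t = ⊥-elim (spike≢0 (cong profile (ℕP.m≤n⇒m∸n≡0 (ℕP.≰⇒> ≰t))))

  Up : V → V → Set
  Up x y = adj G x y ≡ true × level y ≡ suc (level x)

  up? : ∀ x y → Dec (Up x y)
  up? x y = (adj G x y Bool.≟ true) ×-dec (level y ℕ.≟ suc (level x))

  upEnergy : V → V → ℕ
  upEnergy x y = if does (up? x y) then stepEnergy (level x) else 0

  outDegree inDegree : V → ℕ
  outDegree x = count (λ y → does (up? x y))
  inDegree  x = count (λ y → does (up? y x))

  no-2-cycle : ∀ {x y} → Up x y → Up y x → ⊥
  no-2-cycle {x} (_ , y≡1+x) (_ , x≡1+y) =
    ℕP.m≢1+m+n (level x) (trans x≡1+y (cong suc (trans y≡1+x (ℕP.+-comm 1 (level x)))))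

  no-flat-up : ∀ {x y} → level x ≡ level y → ¬ Up x y
  no-flat-up same (_ , y≡1+x) = ℕP.1+n≢n (sym (trans y≡1+x (cong suc same)))

  level-adj-cases : ∀ u w → adj G u w ≡ true → Up u w ⊎ Up w u ⊎ level u ≡ level w
  level-adj-cases u w e with level w ℕ.≟ suc (level u) | level u ℕ.≟ suc (level w)
  ... | yes w≡1+u | _         = inj₁ (e , w≡1+u)
  ... | no  _     | yes u≡1+w = inj₂ (inj₁ (trans (Graph.sym G w u) e , u≡1+w))
  ... | no  w≢1+u | no  u≢1+w = inj₂ (inj₂ (ℕP.≤-antisym
        (ℕP.≤-pred (ℕP.≤∧≢⇒< (level-adj w u (trans (Graph.sym G w u) e)) u≢1+w))
        (ℕP.≤-pred (ℕP.≤∧≢⇒< (level-adj u w e) w≢1+u))))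

  edge-energy : ∀ u w → adj G u w ≡ true → ∣ spike u - spike w ∣² ≡ upEnergy u w + upEnergy w u
  edge-energy u w e with level-adj-cases u w e
  ... | inj₁ up = begin
    ∣ spike u - spike w ∣²         ≡⟨ cong (λ l → ∣ spike u - profile (height l) ∣²) (proj₂ up) ⟩
    stepEnergy (level u)          ≡⟨ ℕP.+-identityʳ _ ⟨
    stepEnergy (level u) + 0      ≡⟨ cong₂ _+_ (if-yes (up? u w) up) (if-no (up? w u) (no-2-cycle up)) ⟨
    upEnergy u w + upEnergy w u   ∎
    where open ≡-Reasoning
  ... | inj₂ (inj₁ down) = begin
    ∣ spike u - spike w ∣²         ≡⟨ cong (λ d → d * d) (ℕP.∣-∣-comm (spike u) (spike w)) ⟩
    ∣ spike w - spike u ∣²         ≡⟨ cong (λ l → ∣ spike w - profile (height l) ∣²) (proj₂ down) ⟩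
    stepEnergy (level w)          ≡⟨ cong₂ _+_ (if-no (up? u w) (λ up → no-2-cycle up down))
                                               (if-yes (up? w u) down) ⟨
    upEnergy u w + upEnergy w u   ∎
    where open ≡-Reasoning
  ... | inj₂ (inj₂ same) = begin
    ∣ spike u - spike w ∣²         ≡⟨ cong (λ l → ∣ spike u - profile (height l) ∣²) (sym same) ⟩
    ∣ spike u - spike u ∣²         ≡⟨ cong (λ d → d * d) (ℕP.∣n-n∣≡0 (spike u)) ⟩
    0                             ≡⟨ cong₂ _+_ (if-no (up? u w) (no-flat-up same))
                                               (if-no (up? w u) (no-flat-up (sym same))) ⟨
    upEnergy u w + upEnergy w u   ∎
    where open ≡-Reasoning

  energy≤∑∑upEnergy : energyℕ G spike ≤ ∑∑ upEnergy
  energy≤∑∑upEnergy = ℕP.≤-trans (∑∑-mono-≤ edge-term≤) (∑∑-ordered-pairs upEnergy)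
    where
    edge-term≤ : ∀ x y → (if adj G x y then (if toℕ x ℕ.<ᵇ toℕ y then ∣ spike x - spike y ∣² else 0) else 0)
                         ≤ (if toℕ x ℕ.<ᵇ toℕ y then upEnergy x y + upEnergy y x else 0)
    edge-term≤ x y = if-≤ (adj G x y) λ e →
                     ℕP.≤-reflexive (Bool.if-cong-then (toℕ x ℕ.<ᵇ toℕ y) (edge-energy x y e))

  out+in≤ : ∀ x → outDegree x + inDegree x ≤ suc q
  out+in≤ x = begin
    outDegree x + inDegree x
      ≡⟨ cong₂ _+_ (count≡∑ (λ y → does (up? x y))) (count≡∑ (λ y → does (up? y x))) ⟩
    sum (λ y → if does (up? x y) then 1 else 0) + sum (λ y → if does (up? y x) then 1 else 0)
      ≡⟨ ∑-distrib-+ (λ y → if does (up? x y) then 1 else 0) (λ y → if does (up? y x) then 1 else 0) ⟨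
    sum (λ y → (if does (up? x y) then 1 else 0) + (if does (up? y x) then 1 else 0))
      ≤⟨ ∑-mono-≤ (λ y → if-exclusive (up? x y) (up? y x) (adj G x y) proj₁
                            (λ y→x → trans (Graph.sym G x y) (proj₁ y→x)) no-2-cycle) ⟩
    sum (λ y → if adj G x y then 1 else 0)
      ≡⟨ count≡∑ (adj G x) ⟨
    degree G x
      ≤⟨ ≤-maxFin (degree G) x ⟩
    maxDegree G
      ≤⟨ maxDegree≤ ⟩
    suc q ∎
    where open ℕP.≤-Reasoning

  has-parent : ∀ x → x ≢ r → level x ≤ t → 1 ≤ inDegree x
  has-parent x x≢r ≤t = from-parent (level-parent x level≡ (subst (_≤ t) level≡ ≤t))
    where
    level≡ : level x ≡ suc (ℕ.pred (level x))
    level≡ = sym (ℕP.suc-pred (level x) {{ℕ.≢-nonZero (x≢r ∘ sym ∘ level-zero x)}})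
    from-parent : Σ V (λ z → adj G z x ≡ true × level z ≡ ℕ.pred (level x)) → 1 ≤ inDegree x
    from-parent (z , z→x , level-z≡) = begin
      1                                          ≡⟨ if-yes (up? z x) (z→x , trans level≡ (cong suc (sym level-z≡))) ⟨
      (if does (up? z x) then 1 else 0)          ≤⟨ term-≤-∑ (λ y → if does (up? y x) then 1 else 0) z ⟩
      sum (λ y → if does (up? y x) then 1 else 0) ≡⟨ count≡∑ (λ y → does (up? y x)) ⟨
      inDegree x                                 ∎
      where open ℕP.≤-Reasoning

  out≤q·in : ∀ x → 1 ≤ inDegree x → outDegree x ≤ q * inDegree x
  out≤q·in x 1≤in = begin
    outDegree x      ≤⟨ ℕP.≤-pred (begin
      suc (outDegree x)           ≡⟨ ℕP.+-comm 1 (outDegree x) ⟩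
      outDegree x + 1             ≤⟨ ℕP.+-monoʳ-≤ (outDegree x) 1≤in ⟩
      outDegree x + inDegree x    ≤⟨ out+in≤ x ⟩
      suc q                       ∎) ⟩
    q                ≡⟨ ℕP.*-identityʳ q ⟨
    q * 1            ≤⟨ ℕP.*-monoʳ-≤ q 1≤in ⟩
    q * inDegree x   ∎
    where open ℕP.≤-Reasoning

  rootCharge : V → ℕ
  rootCharge x = if does (x ≟ r) then suc q * potential 0 else 0

  charge : ∀ x → outDegree x * potential (level x) ≤ q * (inDegree x * potential (level x)) + rootCharge x
  charge x with x ≟ r
  ... | yes refl = begin
    outDegree r * potential (level r)  ≡⟨ cong (λ l → outDegree r * potential l) level-root ⟩
    outDegree r * potential 0          ≤⟨ ℕP.*-monoˡ-≤ (potential 0) out≤1+q ⟩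
    suc q * potential 0                ≤⟨ ℕP.m≤n+m (suc q * potential 0) (q * (inDegree r * potential (level r))) ⟩
    q * (inDegree r * potential (level r)) + suc q * potential 0 ∎
    where
    open ℕP.≤-Reasoning
    out≤1+q : outDegree r ≤ suc q
    out≤1+q = ℕP.≤-trans (ℕP.m≤m+n (outDegree r) (inDegree r)) (out+in≤ r)
  ... | no x≢r with level x ≤? t
  ...   | no ≰t  = begin
    outDegree x * potential (level x)  ≡⟨ cong (outDegree x *_) (potential-vanish (level x) (ℕP.≰⇒> ≰t)) ⟩
    outDegree x * 0                    ≡⟨ ℕP.*-zeroʳ (outDegree x) ⟩
    0                                  ≤⟨ z≤n ⟩
    q * (inDegree x * potential (level x)) + 0 ∎
    where open ℕP.≤-Reasoning
  ...   | yes ≤t = begin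
    outDegree x * potential (level x)  ≤⟨ ℕP.*-monoˡ-≤ (potential (level x)) (out≤q·in x (has-parent x x≢r ≤t)) ⟩
    q * inDegree x * potential (level x) ≡⟨ ℕP.*-assoc q (inDegree x) (potential (level x)) ⟩
    q * (inDegree x * potential (level x)) ≡⟨ ℕP.+-identityʳ _ ⟨
    q * (inDegree x * potential (level x)) + 0 ∎
    where open ℕP.≤-Reasoning

  ∑∑upEnergy≤ : ∑∑ upEnergy ≤ suc q * potential 0
  ∑∑upEnergy≤ = ℕP.+-cancelʳ-≤ inflow (∑∑ upEnergy) (suc q * potential 0) (begin
    ∑∑ upEnergy + inflow
      ≡⟨ ∑∑-distrib upEnergy (λ x y → if does (up? x y) then q * potential (level y) else 0) split ⟨
    ∑∑ (λ x y → if does (up? x y) then potential (level x) else 0)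
      ≡⟨ sum-cong-≗ (λ x → count-* (λ y → does (up? x y)) (potential (level x))) ⟨
    sum (λ x → outDegree x * potential (level x))
      ≤⟨ ∑-mono-≤ charge ⟩
    sum (λ x → q * (inDegree x * potential (level x)) + rootCharge x)
      ≡⟨ ∑-distrib-+ (λ x → q * (inDegree x * potential (level x))) rootCharge ⟩
    sum (λ x → q * (inDegree x * potential (level x))) + sum rootCharge
      ≡⟨ cong₂ _+_ inflow-by-heads (∑-δ r (suc q * potential 0)) ⟩
    inflow + suc q * potential 0
      ≡⟨ ℕP.+-comm inflow _ ⟩
    suc q * potential 0 + inflow ∎)
    where
    open ℕP.≤-Reasoning
    inflow : ℕ
    inflow = ∑∑ (λ x y → if does (up? x y) then q * potential (level y) else 0)
    split : ∀ x y → (if does (up? x y) then potential (level x) else 0)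
                    ≡ upEnergy x y + (if does (up? x y) then q * potential (level y) else 0)
    split x y = if-split (up? x y) λ (_ , y≡1+x) →
      trans (potential-step (level x)) (cong (λ l → stepEnergy (level x) + q * potential l) (sym y≡1+x))
    inflow-by-heads : sum (λ x → q * (inDegree x * potential (level x))) ≡ inflow
    inflow-by-heads = trans
      (sum-cong-≗ λ x → trans (cong (q *_) (count-* (λ y → does (up? y x)) (potential (level x))))
                       (trans (*-distribˡ-sum q (λ y → if does (up? y x) then potential (level x) else 0))
                              (sum-cong-≗ (λ y → *-if q (does (up? y x)) (potential (level x))))))
      (∑-comm (λ x y → if does (up? y x) then q * potential (level x) else 0))

  spike-energy≤ : energyℕ G spike ≤ suc q * potential 0
  spike-energy≤ = ℕP.≤-trans energy≤∑∑upEnergy ∑∑upEnergy≤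

  branchEnergy-closed : ∀ k → q * branchEnergy (suc k) ≡ q ^ k * (p * q ^ k + 1)
  branchEnergy-closed zero    = base p
    where
    base : ∀ p → suc p * (1 + suc p * 0) ≡ 1 * (p * 1 + 1)
    base = solve-∀
  branchEnergy-closed (suc k) = begin
    q * (∣ q * X - X ∣² + q * branchEnergy (suc k))
      ≡⟨ cong (λ d → q * (d * d + q * branchEnergy (suc k))) ∣qX-X∣ ⟩
    q * (p * X * (p * X) + q * branchEnergy (suc k))
      ≡⟨ cong (λ e → q * (p * X * (p * X) + e)) (branchEnergy-closed k) ⟩
    q * (p * X * (p * X) + X * (p * X + 1))
      ≡⟨ step p X ⟩
    q * X * (p * (q * X) + 1) ∎
    where
    open ≡-Reasoning
    X : ℕ
    X = q ^ k
    ∣qX-X∣ : ∣ q * X - X ∣ ≡ p * X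
    ∣qX-X∣ = trans (ℕP.∣-∣-comm (q * X) X) (ℕP.∣m-m+n∣≡n X (p * X))
    step : ∀ p X → suc p * (p * X * (p * X) + X * (p * X + 1)) ≡ suc p * X * (p * (suc p * X) + 1)
    step = solve-∀

  spike-rayleigh : ∀ B → B r ≡ true →
    energyℕ G spike * q ^ suc t ≤ (q + 1) * (q ^ suc t ∸ q ^ t + 1) * bdryNormℕ G B spike
  spike-rayleigh B Br = begin
    energyℕ G spike * q ^ suc t          ≤⟨ ℕP.*-monoˡ-≤ (q ^ suc t) spike-energy≤ ⟩
    suc q * potential 0 * (q * X)        ≡⟨ rearrange p X (potential 0) ⟩
    suc q * X * (q * potential 0)        ≡⟨ cong (suc q * X *_) (branchEnergy-closed t) ⟩
    suc q * X * (X * (p * X + 1))        ≡⟨ regroup p X ⟩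
    (q + 1) * (p * X + 1) * (X * X)      ≡⟨ cong (λ d → (q + 1) * (d + 1) * (X * X)) (ℕP.m+n∸m≡n X (p * X)) ⟨
    (q + 1) * (q * X ∸ X + 1) * (X * X)  ≤⟨ ℕP.*-monoʳ-≤ ((q + 1) * (q * X ∸ X + 1)) root-term ⟩
    (q + 1) * (q * X ∸ X + 1) * bdryNormℕ G B spike ∎
    where
    open ℕP.≤-Reasoning
    X : ℕ
    X = q ^ t
    rearrange : ∀ p X g → suc (suc p) * g * (suc p * X) ≡ suc (suc p) * X * (suc p * g)
    rearrange = solve-∀
    regroup : ∀ p X → suc (suc p) * X * (X * (p * X + 1)) ≡ (suc p + 1) * (p * X + 1) * (X * X)
    regroup = solve-∀
    root-term : X * X ≤ bdryNormℕ G B spike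
    root-term = ℕP.≤-trans (ℕP.≤-reflexive (sym (trans (Bool.if-cong Br)
                                                        (cong (λ s → s * s) spike-root))))
                           (term-≤-∑ (λ x → if B x then spike x * spike x else 0) r)

module Apart (G : Graph) {s t : ℕ} {x y : Fin (n G)} (far : ¬ Reach G (suc (s + t)) x y)
             (g h : Fin (n G) → ℕ)
             (g-ball : ∀ v → g v ≢ 0 → Reach G s x v) (h-ball : ∀ v → h v ≢ 0 → Reach G t y v) where
  open Walks G

  h-vanishes : ∀ v → Reach G (suc s) x v → h v ≡ 0
  h-vanishes v x→v with h v ℕ.≟ 0
  ... | yes h≡0 = h≡0
  ... | no  h≢0 = ⊥-elim (far (reach-++ x→v (reach-sym (h-ball v h≢0))))

  vertex-apart : ∀ v → g v ≡ 0 ⊎ h v ≡ 0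
  vertex-apart v with g v ℕ.≟ 0
  ... | yes g≡0 = inj₁ g≡0
  ... | no  g≢0 = inj₂ (h-vanishes v (reach-mono (ℕP.n≤1+n s) (g-ball v g≢0)))

  edge-apart : ∀ u w → adj G u w ≡ true → (g u ≡ 0 × g w ≡ 0) ⊎ (h u ≡ 0 × h w ≡ 0)
  edge-apart u w e with g u ℕ.≟ 0 | g w ℕ.≟ 0
  ... | yes gu≡0 | yes gw≡0 = inj₁ (gu≡0 , gw≡0)
  ... | no  gu≢0 | _        =
    inj₂ (h-vanishes u (reach-mono (ℕP.n≤1+n s) x→u) , h-vanishes w (inj₂ (u , x→u , e)))
    where
    x→u : Reach G s x u
    x→u = g-ball u gu≢0
  ... | yes _    | no gw≢0  =
    inj₂ (h-vanishes u (inj₂ (w , x→w , trans (Graph.sym G w u) e)) , h-vanishes w (reach-mono (ℕP.n≤1+n s) x→w))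
    where
    x→w : Reach G s x w
    x→w = g-ball w gw≢0

ι-∣-∣²-≤ : ∀ {m n} → m ≤ n → ι ∣ m - n ∣² ≡ sq (ι m ℚ.- ι n)
ι-∣-∣²-≤ {m} {n} m≤n = subst (λ n → ι ∣ m - n ∣² ≡ sq (ι m ℚ.- ι n)) (ℕP.m+[n∸m]≡n m≤n) (begin
  ι ∣ m - m + d ∣²                  ≡⟨ cong (λ e → ι (e * e)) (ℕP.∣m-m+n∣≡n m d) ⟩
  ι (d * d)                        ≡⟨ ι-* d d ⟩
  ι d ℚ.* ι d                      ≡⟨ sq-gap (ι m) (ι d) ⟩
  sq (ι m ℚ.- (ι m ℚ.+ ι d))       ≡⟨ cong (λ e → sq (ι m ℚ.- e)) (ι-+ m d) ⟨
  sq (ι m ℚ.- ι (m + d))           ∎)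
  where
  open ≡-Reasoning
  d = n ∸ m
  sq-gap : ∀ a d → d ℚ.* d ≡ (a ℚ.- (a ℚ.+ d)) ℚ.* (a ℚ.- (a ℚ.+ d))
  sq-gap = solve 2 (λ a d → d :* d := (a :- (a :+ d)) :* (a :- (a :+ d))) refl

ι-∣-∣² : ∀ m n → ι ∣ m - n ∣² ≡ sq (ι m ℚ.- ι n)
ι-∣-∣² m n with ℕP.≤-total m n
... | inj₁ m≤n = ι-∣-∣²-≤ m≤n
... | inj₂ n≤m = begin
    ι ∣ m - n ∣²                      ≡⟨ cong (λ e → ι (e * e)) (ℕP.∣-∣-comm m n) ⟩
    ι ∣ n - m ∣²                      ≡⟨ ι-∣-∣²-≤ n≤m ⟩
    sq (ι n ℚ.- ι m)                 ≡⟨ sq-swap (ι n) (ι m) ⟩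
    sq (ι m ℚ.- ι n)                 ∎
  where
  open ≡-Reasoning
  sq-swap : ∀ a b → (a ℚ.- b) ℚ.* (a ℚ.- b) ≡ (b ℚ.- a) ℚ.* (b ℚ.- a)
  sq-swap = solve 2 (λ a b → (a :- b) :* (a :- b) := (b :- a) :* (b :- a)) refl

energy-ι : ∀ G (g : Fin (n G) → ℕ) → energy G (ι ∘ g) ≡ ι (energyℕ G g)
energy-ι G g = trans (sumℚ-cong (λ x → trans (sumℚ-cong (edge-term x)) (sumℚ-ι (term x))))
                     (sumℚ-ι (λ x → sum (term x)))
  where
  term : Fin (n G) → Fin (n G) → ℕ
  term x y = if adj G x y then (if toℕ x ℕ.<ᵇ toℕ y then ∣ g x - g y ∣² else 0) else 0
  edge-term : ∀ x y → (if adj G x y then (if toℕ x ℕ.<ᵇ toℕ y then sq (ι (g x) ℚ.- ι (g y)) else 0ℚ) else 0ℚ)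
                      ≡ ι (term x y)
  edge-term x y = sym (trans (Bool.if-float ι (adj G x y)) (Bool.if-cong-then (adj G x y)
                        (trans (Bool.if-float ι (toℕ x ℕ.<ᵇ toℕ y))
                               (Bool.if-cong-then (toℕ x ℕ.<ᵇ toℕ y) (ι-∣-∣² (g x) (g y))))))

bdryNorm-ι : ∀ G B (g : Fin (n G) → ℕ) → bdryNorm G B (ι ∘ g) ≡ ι (bdryNormℕ G B g)
bdryNorm-ι G B g = trans (sumℚ-cong λ x → sym (trans (Bool.if-float ι (B x))
                                                     (Bool.if-cong-then (B x) (ι-* (g x) (g x)))))
                         (sumℚ-ι (λ x → if B x then g x * g x else 0))

bdrySum-ι : ∀ G B (g : Fin (n G) → ℕ) → bdrySum G B (ι ∘ g) ≡ ι (bdrySumℕ G B g)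
bdrySum-ι G B g = trans (sumℚ-cong (λ x → sym (Bool.if-float ι (B x)))) (sumℚ-ι (λ x → if B x then g x else 0))

if-lincomb : ∀ b {x u w : ℚ} a c → (b ≡ true → x ≡ a ℚ.* u ℚ.+ c ℚ.* w) →
  (if b then x else 0ℚ) ≡ a ℚ.* (if b then u else 0ℚ) ℚ.+ c ℚ.* (if b then w else 0ℚ)
if-lincomb true  a c x≡ = x≡ refl
if-lincomb false a c x≡ = 0≡lincomb-0 a c

sq-apart : ∀ a c u w → u ≡ 0ℚ ⊎ w ≡ 0ℚ →
  sq (a ℚ.* u ℚ.- c ℚ.* w) ≡ a ℚ.* a ℚ.* sq u ℚ.+ c ℚ.* c ℚ.* sq w
sq-apart a c _ w (inj₁ refl) = only-w a c w
  where
  only-w : ∀ a c w → (a ℚ.* 0ℚ ℚ.- c ℚ.* w) ℚ.* (a ℚ.* 0ℚ ℚ.- c ℚ.* w)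
                     ≡ a ℚ.* a ℚ.* (0ℚ ℚ.* 0ℚ) ℚ.+ c ℚ.* c ℚ.* (w ℚ.* w)
  only-w = solve 3 (λ a c w → (a :* con 0ℚ :- c :* w) :* (a :* con 0ℚ :- c :* w)
                           := a :* a :* (con 0ℚ :* con 0ℚ) :+ c :* c :* (w :* w)) refl
sq-apart a c u _ (inj₂ refl) = only-u a c u
  where
  only-u : ∀ a c u → (a ℚ.* u ℚ.- c ℚ.* 0ℚ) ℚ.* (a ℚ.* u ℚ.- c ℚ.* 0ℚ)
                     ≡ a ℚ.* a ℚ.* (u ℚ.* u) ℚ.+ c ℚ.* c ℚ.* (0ℚ ℚ.* 0ℚ)
  only-u = solve 3 (λ a c u → (a :* u :- c :* con 0ℚ) :* (a :* u :- c :* con 0ℚ)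
                           := a :* a :* (u :* u) :+ c :* c :* (con 0ℚ :* con 0ℚ)) refl

sq-diff-apart : ∀ a c u₁ u₂ w₁ w₂ → (u₁ ≡ 0ℚ × u₂ ≡ 0ℚ) ⊎ (w₁ ≡ 0ℚ × w₂ ≡ 0ℚ) →
  sq ((a ℚ.* u₁ ℚ.- c ℚ.* w₁) ℚ.- (a ℚ.* u₂ ℚ.- c ℚ.* w₂))
    ≡ a ℚ.* a ℚ.* sq (u₁ ℚ.- u₂) ℚ.+ c ℚ.* c ℚ.* sq (w₁ ℚ.- w₂)
sq-diff-apart a c u₁ u₂ w₁ w₂ apart =
  trans (cong sq (regroup a c u₁ u₂ w₁ w₂)) (sq-apart a c (u₁ ℚ.- u₂) (w₁ ℚ.- w₂) (Sum.map diff-0 diff-0 apart))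
  where
  regroup : ∀ a c u₁ u₂ w₁ w₂ →
    (a ℚ.* u₁ ℚ.- c ℚ.* w₁) ℚ.- (a ℚ.* u₂ ℚ.- c ℚ.* w₂) ≡ a ℚ.* (u₁ ℚ.- u₂) ℚ.- c ℚ.* (w₁ ℚ.- w₂)
  regroup = solve 6 (λ a c u₁ u₂ w₁ w₂ → (a :* u₁ :- c :* w₁) :- (a :* u₂ :- c :* w₂)
                                       := a :* (u₁ :- u₂) :- c :* (w₁ :- w₂)) refl
  diff-0 : ∀ {v₁ v₂} → v₁ ≡ 0ℚ × v₂ ≡ 0ℚ → v₁ ℚ.- v₂ ≡ 0ℚ
  diff-0 (refl , refl) = refl

module _ (G : Graph) (a c : ℚ) (g h : Fin (n G) → ℚ) where

  energy-lincomb : (∀ u w → adj G u w ≡ true → (g u ≡ 0ℚ × g w ≡ 0ℚ) ⊎ (h u ≡ 0ℚ × h w ≡ 0ℚ)) →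
    energy G (λ v → a ℚ.* g v ℚ.- c ℚ.* h v) ≡ a ℚ.* a ℚ.* energy G g ℚ.+ c ℚ.* c ℚ.* energy G h
  energy-lincomb apart =
    trans (sumℚ-cong λ x → trans (sumℚ-cong (edge-term x))
                                 (sumℚ-lincomb (a ℚ.* a) (c ℚ.* c) (term g x) (term h x)))
          (sumℚ-lincomb (a ℚ.* a) (c ℚ.* c) (λ x → sumℚ (term g x)) (λ x → sumℚ (term h x)))
    where
    term : (Fin (n G) → ℚ) → Fin (n G) → Fin (n G) → ℚ
    term f x y = if adj G x y then (if toℕ x ℕ.<ᵇ toℕ y then sq (f x ℚ.- f y) else 0ℚ) else 0ℚ
    edge-term : ∀ x y →
      term (λ v → a ℚ.* g v ℚ.- c ℚ.* h v) x y ≡ a ℚ.* a ℚ.* term g x y ℚ.+ c ℚ.* c ℚ.* term h x y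
    edge-term x y = if-lincomb (adj G x y) (a ℚ.* a) (c ℚ.* c) λ e →
                    if-lincomb (toℕ x ℕ.<ᵇ toℕ y) (a ℚ.* a) (c ℚ.* c) λ _ →
                    sq-diff-apart a c (g x) (g y) (h x) (h y) (apart x y e)

  bdryNorm-lincomb : ∀ B → (∀ v → g v ≡ 0ℚ ⊎ h v ≡ 0ℚ) →
    bdryNorm G B (λ v → a ℚ.* g v ℚ.- c ℚ.* h v)
      ≡ a ℚ.* a ℚ.* bdryNorm G B g ℚ.+ c ℚ.* c ℚ.* bdryNorm G B h
  bdryNorm-lincomb B apart =
    trans (sumℚ-cong λ x → if-lincomb (B x) (a ℚ.* a) (c ℚ.* c) λ _ → sq-apart a c (g x) (h x) (apart x))
          (sumℚ-lincomb (a ℚ.* a) (c ℚ.* c) (λ x → if B x then sq (g x) else 0ℚ) (λ x → if B x then sq (h x) else 0ℚ))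

  bdrySum-lincomb : ∀ B →
    bdrySum G B (λ v → a ℚ.* g v ℚ.- c ℚ.* h v) ≡ a ℚ.* bdrySum G B g ℚ.+ (ℚ.- c) ℚ.* bdrySum G B h
  bdrySum-lincomb B = trans (sumℚ-cong (λ x → if-lincomb (B x) a (ℚ.- c) λ _ → minus-as-plus a c (g x) (h x)))
                            (sumℚ-lincomb a (ℚ.- c) (λ x → if B x then g x else 0ℚ) (λ x → if B x then h x else 0ℚ))
    where
    minus-as-plus : ∀ a c u w → a ℚ.* u ℚ.- c ℚ.* w ≡ a ℚ.* u ℚ.+ (ℚ.- c) ℚ.* w
    minus-as-plus = solve 4 (λ a c u w → a :* u :- c :* w := a :* u :+ (:- c) :* w) refl

ι-lincomb : ∀ a b x y → ι (a * a * x + b * b * y) ≡ ι a ℚ.* ι a ℚ.* ι x ℚ.+ ι b ℚ.* ι b ℚ.* ι y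
ι-lincomb a b x y = trans (ι-+ (a * a * x) (b * b * y)) (cong₂ ℚ._+_ (ι-*² a x) (ι-*² b y))
  where
  ι-*² : ∀ a x → ι (a * a * x) ≡ ι a ℚ.* ι a ℚ.* ι x
  ι-*² a x = trans (ι-* (a * a) x) (cong (ℚ._* ι x) (ι-* a a))

lincomb-ratio : ∀ {E₁ E₂ N₁ N₂ m d} α β → E₁ * d ≤ m * N₁ → E₂ * d ≤ m * N₂ →
  (α * E₁ + β * E₂) * d ≤ m * (α * N₁ + β * N₂)
lincomb-ratio {E₁} {E₂} {N₁} {N₂} {m} {d} α β E₁≤ E₂≤ = begin
  (α * E₁ + β * E₂) * d          ≡⟨ distribute α β E₁ E₂ d ⟩
  α * (E₁ * d) + β * (E₂ * d)    ≤⟨ ℕP.+-mono-≤ (ℕP.*-monoʳ-≤ α E₁≤) (ℕP.*-monoʳ-≤ β E₂≤) ⟩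
  α * (m * N₁) + β * (m * N₂)    ≡⟨ factor α β m N₁ N₂ ⟩
  m * (α * N₁ + β * N₂)          ∎
  where
  open ℕP.≤-Reasoning
  distribute : ∀ α β E₁ E₂ d → (α * E₁ + β * E₂) * d ≡ α * (E₁ * d) + β * (E₂ * d)
  distribute = solve-∀
  factor : ∀ α β m N₁ N₂ → α * (m * N₁) + β * (m * N₂) ≡ m * (α * N₁ + β * N₂)
  factor = solve-∀

module TwoBumps (G : Graph) (B : Boundary G) (g h : Fin (n G) → ℕ)
                (vertex-apart : ∀ v → g v ≡ 0 ⊎ h v ≡ 0)
                (edge-apart : ∀ u w → adj G u w ≡ true → (g u ≡ 0 × g w ≡ 0) ⊎ (h u ≡ 0 × h w ≡ 0)) where

  a b : ℕ
  a = bdrySumℕ G B h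
  b = bdrySumℕ G B g

  f : Fin (n G) → ℚ
  f v = ι a ℚ.* ι (g v) ℚ.- ι b ℚ.* ι (h v)

  energy-f : energy G f ≡ ι (a * a * energyℕ G g + b * b * energyℕ G h)
  energy-f = begin
    energy G f
      ≡⟨ energy-lincomb G (ι a) (ι b) (ι ∘ g) (ι ∘ h) (λ u w e → Sum.map both-ι both-ι (edge-apart u w e)) ⟩
    ι a ℚ.* ι a ℚ.* energy G (ι ∘ g) ℚ.+ ι b ℚ.* ι b ℚ.* energy G (ι ∘ h)
      ≡⟨ cong₂ (λ E F → ι a ℚ.* ι a ℚ.* E ℚ.+ ι b ℚ.* ι b ℚ.* F) (energy-ι G g) (energy-ι G h) ⟩
    ι a ℚ.* ι a ℚ.* ι (energyℕ G g) ℚ.+ ι b ℚ.* ι b ℚ.* ι (energyℕ G h)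
      ≡⟨ ι-lincomb a b (energyℕ G g) (energyℕ G h) ⟨
    ι (a * a * energyℕ G g + b * b * energyℕ G h) ∎
    where
    open ≡-Reasoning
    both-ι : ∀ {m n} → m ≡ 0 × n ≡ 0 → ι m ≡ 0ℚ × ι n ≡ 0ℚ
    both-ι = Product.map (cong ι) (cong ι)

  bdryNorm-f : bdryNorm G B f ≡ ι (a * a * bdryNormℕ G B g + b * b * bdryNormℕ G B h)
  bdryNorm-f = begin
    bdryNorm G B f
      ≡⟨ bdryNorm-lincomb G (ι a) (ι b) (ι ∘ g) (ι ∘ h) B (λ v → Sum.map (cong ι) (cong ι) (vertex-apart v)) ⟩
    ι a ℚ.* ι a ℚ.* bdryNorm G B (ι ∘ g) ℚ.+ ι b ℚ.* ι b ℚ.* bdryNorm G B (ι ∘ h)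
      ≡⟨ cong₂ (λ M N → ι a ℚ.* ι a ℚ.* M ℚ.+ ι b ℚ.* ι b ℚ.* N) (bdryNorm-ι G B g) (bdryNorm-ι G B h) ⟩
    ι a ℚ.* ι a ℚ.* ι (bdryNormℕ G B g) ℚ.+ ι b ℚ.* ι b ℚ.* ι (bdryNormℕ G B h)
      ≡⟨ ι-lincomb a b (bdryNormℕ G B g) (bdryNormℕ G B h) ⟨
    ι (a * a * bdryNormℕ G B g + b * b * bdryNormℕ G B h) ∎
    where open ≡-Reasoning

  bdrySum-f : bdrySum G B f ≡ 0ℚ
  bdrySum-f = begin
    bdrySum G B f
      ≡⟨ bdrySum-lincomb G (ι a) (ι b) (ι ∘ g) (ι ∘ h) B ⟩
    ι a ℚ.* bdrySum G B (ι ∘ g) ℚ.+ (ℚ.- ι b) ℚ.* bdrySum G B (ι ∘ h)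
      ≡⟨ cong₂ (λ S T → ι a ℚ.* S ℚ.+ (ℚ.- ι b) ℚ.* T) (bdrySum-ι G B g) (bdrySum-ι G B h) ⟩
    ι a ℚ.* ι b ℚ.+ (ℚ.- ι b) ℚ.* ι a
      ≡⟨ cancel (ι a) (ι b) ⟩
    0ℚ ∎
    where
    open ≡-Reasoning
    cancel : ∀ a b → a ℚ.* b ℚ.+ (ℚ.- b) ℚ.* a ≡ 0ℚ
    cancel = solve 2 (λ a b → a :* b :+ (:- b) :* a := con 0ℚ) refl

  f-nonzero : ∀ x → 0 ℕ.< a → 0 ℕ.< g x → f x ≢ 0ℚ
  f-nonzero x 0<a 0<gx fx≡0 = ℕP.n>0⇒n≢0 (ℕP.*-mono-≤ 0<a 0<gx) (ι-injective (trans (sym fx≡ι) fx≡0))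
    where
    hx≡0 : h x ≡ 0
    hx≡0 = Sum.[ (λ gx≡0 → ⊥-elim (ℕP.n>0⇒n≢0 0<gx gx≡0)) , (λ hx≡0 → hx≡0) ] (vertex-apart x)
    drop-0 : ∀ a u b → a ℚ.* u ℚ.- b ℚ.* 0ℚ ≡ a ℚ.* u
    drop-0 = solve 3 (λ a u b → a :* u :- b :* con 0ℚ := a :* u) refl
    fx≡ι : f x ≡ ι (a * g x)
    fx≡ι = trans (cong (λ k → ι a ℚ.* ι (g x) ℚ.- ι b ℚ.* ι k) hx≡0)
                 (trans (drop-0 (ι a) (ι (g x)) (ι b)) (sym (ι-* a (g x))))

  σ₂≤-two-bumps : ∀ m d .{{_ : NonZero d}} x y → B x ≡ true → B y ≡ true → 0 ℕ.< g x → 0 ℕ.< h y →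
    energyℕ G g * d ≤ m * bdryNormℕ G B g → energyℕ G h * d ≤ m * bdryNormℕ G B h →
    σ₂≤ G B (ℤ.+ m ℚ./ d)
  σ₂≤-two-bumps m d x y Bx By 0<gx 0<hy g-ratio h-ratio ε 0<ε =
    f , ((x , Bx , f-nonzero x 0<a 0<gx) , bdrySum-f) , (begin
      energy G f          ≡⟨ energy-f ⟩
      ι E                 ≤⟨ ι-≤-/-* E m N d (lincomb-ratio {m = m} (a * a) (b * b) g-ratio h-ratio) ⟩
      K ℚ.* ι N           ≤⟨ ℚP.*-monoʳ-≤-nonNeg (ι N) K≤K+ε ⟩
      (K ℚ.+ ε) ℚ.* ι N   ≡⟨ cong ((K ℚ.+ ε) ℚ.*_) bdryNorm-f ⟨
      (K ℚ.+ ε) ℚ.* bdryNorm G B f ∎)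
    where
    open ℚP.≤-Reasoning
    K : ℚ
    K = ℤ.+ m ℚ./ d
    E N : ℕ
    E = a * a * energyℕ G g + b * b * energyℕ G h
    N = a * a * bdryNormℕ G B g + b * b * bdryNormℕ G B h
    K≤K+ε : K ℚ.≤ K ℚ.+ ε
    K≤K+ε = ℚP.≤-trans (ℚP.≤-reflexive (sym (ℚP.+-identityʳ K))) (ℚP.+-monoʳ-≤ K (ℚP.<⇒≤ 0<ε))
    0<a : 0 ℕ.< a
    0<a = ℕP.≤-trans 0<hy (ℕP.≤-trans (ℕP.≤-reflexive (Bool.if-cong (sym By)))
                                      (term-≤-∑ (λ v → if B v then h v else 0) y))

bound-decreasing : ∀ q .{{_ : NonZero q}} → 2 ≤ q → ∀ s → bound q (suc s) < bound q s
bound-decreasing q@(suc (suc p)) (s≤s (s≤s z≤n)) s =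
  /-<-/ (numerator (suc s)) (numerator s) (q ^ suc (suc s)) (q ^ suc s)
        {{ℕP.m^n≢0 q (suc (suc s))}} {{ℕP.m^n≢0 q (suc s)}} (begin-strict
    (q + 1) * (q * Y ∸ Y + 1) * Y
      ≡⟨ cong (λ d → (q + 1) * (d + 1) * Y) (ℕP.m+n∸m≡n Y (suc p * Y)) ⟩
    (q + 1) * (suc p * Y + 1) * Y
      <⟨ ℕP.m<m+n _ (ℕP.*-mono-≤ {1} {(q + 1) * q * suc p} (s≤s z≤n) (ℕP.m^n>0 q s)) ⟩
    (q + 1) * (suc p * Y + 1) * Y + (q + 1) * q * suc p * X
      ≡⟨ expand p X ⟩
    (q + 1) * (suc p * X + 1) * (q * Y)
      ≡⟨ cong (λ d → (q + 1) * (d + 1) * (q * Y)) (ℕP.m+n∸m≡n X (suc p * X)) ⟨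
    (q + 1) * (q * X ∸ X + 1) * (q * Y) ∎)
  where
  open ℕP.≤-Reasoning
  numerator : ℕ → ℕ
  numerator s = (q + 1) * (q ^ suc s ∸ q ^ s + 1)
  X Y : ℕ
  X = q ^ s
  Y = q * X
  expand : ∀ p X → (suc (suc p) + 1) * (suc p * (suc (suc p) * X) + 1) * (suc (suc p) * X)
                   + (suc (suc p) + 1) * suc (suc p) * suc p * X
                 ≡ (suc (suc p) + 1) * (suc p * X + 1) * (suc (suc p) * (suc (suc p) * X))
  expand = solve-∀

diameter-index : ∀ t → 2 * t + 2 ∸ 1 ≡ suc (t + t)
diameter-index t = trans (ℕP.+-∸-assoc (2 * t) (s≤s z≤n)) (twice t)
  where
  twice : ∀ t → 2 * t + 1 ≡ suc (t + t)
  twice = solve-∀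

σ₂≤-bound : ∀ G B q .{{_ : NonZero q}} → maxDegree G ≤ suc q → ∀ t →
  BoundaryDiamAtLeast G B (2 * t + 2) → σ₂≤ G B (bound q t)
σ₂≤-bound G B q@(suc p) maxDegree≤ t (x , y , Bx , By , far) =
  TwoBumps.σ₂≤-two-bumps G B X.spike Y.spike A.vertex-apart A.edge-apart
    ((q + 1) * (q ^ suc t ∸ q ^ t + 1)) (q ^ suc t) {{ℕP.m^n≢0 q (suc t)}} x y Bx By
    (spike-positive X.spike-root) (spike-positive Y.spike-root) (X.spike-rayleigh B Bx) (Y.spike-rayleigh B By)
  where
  module X = Spike G x t p maxDegree≤
  module Y = Spike G y t p maxDegree≤
  far′ : ¬ Reach G (suc (t + t)) x y
  far′ = far ∘ subst (λ k → Reach G k x y) (sym (diameter-index t))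
  module A = Apart G far′ X.spike Y.spike X.spike-ball Y.spike-ball
  spike-positive : ∀ {m} → m ≡ q ^ t → 0 ℕ.< m
  spike-positive m≡ = subst (0 ℕ.<_) (sym m≡) (ℕP.m^n>0 q t)

theorem3p1 : (G : Graph) (B : Boundary G) → 2 ≤ card G B →
    (Δ≥3 : 3 ≤ maxDegree G) → (t : ℕ) → 1 ≤ t →
    BoundaryDiamAtLeast G B (2 * t + 2) →
    σ₂≤ G B (bound (maxDegree G ∸ 1) t {{q-nonZero Δ≥3}})
    × ((s : ℕ) → 1 ≤ s →
        bound (maxDegree G ∸ 1) (suc s) {{q-nonZero Δ≥3}}
          < bound (maxDegree G ∸ 1) s {{q-nonZero Δ≥3}})
theorem3p1 G B _ Δ≥3 t _ diam =
  σ₂≤-bound G B (maxDegree G ∸ 1) {{q-nonZero Δ≥3}} (ℕP.m≤n+m∸n (maxDegree G) 1) t diam ,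
  λ s _ → bound-decreasing (maxDegree G ∸ 1) {{q-nonZero Δ≥3}} (ℕP.∸-monoˡ-≤ 1 Δ≥3) s
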